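{- Let $D$ be a directed graph on $[n]$ (loops allowed), and for $q\ge 2$ let $\mathrm{minrank}[D,q]=\min\{\operatorname{rank}(f): f\in F[D,q]\}$ and $\mathrm{minrank}[D]=\min\{\mathrm{minrank}[D,q]: q\ge 2\}$. Then \[ \mathrm{minrank}[D]=\lim_{q\to\infty}\mathrm{minrank}[D,q]\le \mathrm{minrank}[D,2]\le 2^n. \]
   Context: For an integer $q\ge 2$ let $\langle q\rangle=\{0,1,\dots,q-1\}$. For $f=(f_1,\dots,f_n):\langle q\rangle^n\to\langle q\rangle^n$, the interaction graph $\mathrm{IG}(f)$ is the directed graph on $[n]$ with an arc $uv$ (possibly $u=v$) if and only if there exist $a,b\in\langle q\rangle^n$ that differ only in coordinate $u$ and satisfy $f_v(a)\ne f_v(b)$. $F[D,q]$ is the set of all $f:\langle q\rangle^n\to\langle q\rangle^n$ with $\mathrm{IG}(f)=D$ exactly. The rank of $f$ is $\operatorname{rank}(f)=|\{f(y): y\in\langle q\rangle^n\}|$. -}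

module Defs where

open import Data.Nat using (ℕ; zero; suc; _≤_; _^_)
open import Data.Fin using (Fin)
open import Data.Fin.Properties using () renaming (_≟_ to _≟ᶠ_)
open import Data.Bool using (Bool; true)
open import Data.Vec using (Vec; []; _∷_; lookup)
open import Data.Vec.Properties using (≡-dec)
open import Data.List using (List; []; _∷_; map; concatMap; length; deduplicate)
open import Data.Fin.Base using () renaming (toℕ to toℕᶠ)
open import Data.List using (allFin)
open import Data.Product using (Σ; ∃; ∃-syntax; _×_)
open import Relation.Binary.PropositionalEquality using (_≡_; _≢_)
open import Function.Bundles using (_⇔_)

State : ℕ → ℕ → Set
State q n = Vec (Fin q) n

Map : ℕ → ℕ → Set
Map q n = State q n → State q n

Digraph : ℕ → Set
Digraph n = Fin n → Fin n → Bool

allStates : (q n : ℕ) → List (State q n)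
allStates q zero = [] ∷ []
allStates q (suc n) = concatMap (λ x → map (x ∷_) (allStates q n)) (allFin q)

rank : ∀ {q n} → Map q n → ℕ
rank {q} {n} f = length (deduplicate (≡-dec _≟ᶠ_) (map f (allStates q n)))

IGArc : ∀ {q n} → Map q n → Fin n → Fin n → Set
IGArc {q} {n} f u v =
  ∃[ a ] ∃[ b ] ((∀ w → w ≢ u → lookup a w ≡ lookup b w)
                 × lookup (f a) v ≢ lookup (f b) v)

InF : ∀ {n} → Digraph n → (q : ℕ) → Map q n → Set
InF D q f = ∀ u v → (D u v ≡ true) ⇔ IGArc f u v

IsMinrankq : ∀ {n} → Digraph n → ℕ → ℕ → Set
IsMinrankq {n} D q m =
  (∃[ f ] (InF D q f × rank f ≡ m)) × (∀ (f : Map q n) → InF D q f → m ≤ rank f)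

IsMinrank : ∀ {n} → Digraph n → ℕ → Set
IsMinrank D m =
  (∃[ q ] (2 ≤ q × IsMinrankq D q m))
  × (∀ q m' → 2 ≤ q → IsMinrankq D q m' → m ≤ m')

-- Recoding a network f over ⟨q⟩ as ρ ∘ f ∘ σ, where ρ : ⟨q⟩ → ⟨p⟩ and σ : ⟨p⟩ → ⟨q⟩ with σ ∘ ρ
-- the identity on a set W of values, never increases the rank and preserves every arc having a
-- witness with all its values in W. Taking W = ⟨q⟩ (p ≥ q) shows that minrank[D,q] is
-- non-increasing in q; taking for W the at most n²(2n+2) values of one witness per arc shows that
-- minrank[D,q] ≥ minrank[D,B] for a bound B depending only on n. Hence minrank[D] = minrank[D,B]
-- = minrank[D,q] for all q ≥ B. The minima exist because F[D,q] is a decidable subset of a finite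
-- set, nonempty thanks to the AND network f_v(x) = [x_w = 1 for every arc wv].
module Submission where

open import Defs
open import Data.Bool using (true; false; if_then_else_)
import Data.Bool.Properties as Bool
open import Data.Empty using (⊥-elim)
open import Data.Fin as Fin using (Fin; toℕ; fromℕ<; inject≤)
open import Data.Fin.Properties using (toℕ-injective; toℕ-fromℕ<; toℕ-inject≤; toℕ<n; all?)
  renaming (_≟_ to _≟ᶠ_)
open import Data.List as List
  using (List; []; _∷_; _++_; map; concatMap; length; allFin; deduplicate; filter; removeAt)
open import Data.List.Extrema.Nat using (argmin; argmin-all; f[argmin]≤f[xs])
open import Data.List.Membership.Propositional using (_∈_; lose)
open import Data.List.Membership.Propositional.Properties
  using (∈-map⁺; ∈-map⁻; ∈-concatMap⁺; ∈-++⁺ˡ; ∈-++⁺ʳ; ∈-allFin; ∈-filter⁺; ∈-deduplicate⁺; ∈-deduplicate⁻)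
open import Data.List.Properties
  using (length-++; length-map; length-tabulate; length-removeAt′; length-deduplicate; map-cong)
open import Data.List.Relation.Binary.Subset.Propositional using (_⊆_)
import Data.List.Relation.Unary.All as All
open import Data.List.Relation.Unary.All.Properties using (all-filter)
open import Data.List.Relation.Unary.Any as Any using (here; there; index; satisfied; any?)
open import Data.List.Relation.Unary.Any.Properties using (lookup-index)
open import Data.List.Relation.Unary.Unique.Propositional using (Unique; _∷_)
open import Data.List.Relation.Unary.Unique.DecPropositional.Properties using (deduplicate-!)
open import Data.Nat using (ℕ; zero; suc; _≤_; _<_; _^_; _+_; _*_; z≤n; s≤s; _<?_)
open import Data.Nat.Properties
  using (≤-refl; ≤-trans; ≤-reflexive; ≤-antisym; +-mono-≤; m≤n⇒m≤1+n; module ≤-Reasoning)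
open import Data.Product using (Σ-syntax; ∃; ∃-syntax; _×_; _,_; proj₁; proj₂)
open import Data.Vec as Vec using (Vec; []; _∷_; lookup; toList; replicate; tabulate; _[_]≔_)
open import Data.Vec.Membership.Propositional using () renaming (_∈_ to _∈ᵥ_)
import Data.Vec.Relation.Unary.Any as VecAny
open import Data.Vec.Membership.Propositional.Properties using (∈-toList⁺)
open import Data.Vec.Properties
  using ( ≡-dec; lookup-map; map-∘; lookup∘tabulate; lookup-replicate; lookup∘update; lookup∘update′
        ; length-toList)
open import Function using (_∘_; case_of_; _⇔_; mk⇔; Equivalence)
import Function.Properties.Equivalence as ⇔
open import Relation.Binary.Definitions using (DecidableEquality)
open import Relation.Binary.PropositionalEquality
open import Relation.Nullary using (¬_; Dec; yes; no; does; ¬?; _×-dec_; _→-dec_)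
open import Relation.Nullary.Decidable using (map′; does-⇔; dec-true; dec-false)

private
  variable
    n p q : ℕ

_≟ˢ_ : DecidableEquality (State q n)
_≟ˢ_ = ≡-dec _≟ᶠ_

∈-allStates : (x : State q n) → x ∈ allStates q n
∈-allStates {q} {zero}  []      = here refl
∈-allStates {q} {suc n} (i ∷ x) =
  ∈-concatMap⁺ _ (Any.map (λ { refl → ∈-map⁺ (i ∷_) (∈-allStates x) }) (∈-allFin i))

length-allFin : ∀ k → length (allFin k) ≡ k
length-allFin k = length-tabulate {n = k} (λ i → i)

length-concatMap-≤ : ∀ {A B : Set} (f : A → List B) {k} → (∀ x → length (f x) ≤ k) →
                     ∀ xs → length (concatMap f xs) ≤ length xs * k
length-concatMap-≤ f f≤k []       = z≤n
length-concatMap-≤ f f≤k (x ∷ xs) =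
  ≤-trans (≤-reflexive (length-++ (f x))) (+-mono-≤ (f≤k x) (length-concatMap-≤ f f≤k xs))

length-allStates-≤ : ∀ q n → length (allStates q n) ≤ q ^ n
length-allStates-≤ q zero    = ≤-refl
length-allStates-≤ q (suc n) =
  ≤-trans (length-concatMap-≤ _ (λ i → ≤-trans (≤-reflexive (length-map (i ∷_) (allStates q n)))
                                                (length-allStates-≤ q n))
                              (allFin q))
          (≤-reflexive (cong (_* q ^ n) (length-allFin q)))

∈-removeAt : ∀ {A : Set} {x y : A} {ys} (x∈ys : x ∈ ys) → y ∈ ys → y ≢ x → y ∈ removeAt ys (index x∈ys)
∈-removeAt (here refl) (here refl)  y≢x = ⊥-elim (y≢x refl)
∈-removeAt (here refl) (there y∈ys) _   = y∈ys
∈-removeAt (there x∈ys) (here refl) _   = here refl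
∈-removeAt (there x∈ys) (there y∈ys) y≢x = there (∈-removeAt x∈ys y∈ys y≢x)

Unique-length-≤ : ∀ {A : Set} {xs ys : List A} → Unique xs → xs ⊆ ys → length xs ≤ length ys
Unique-length-≤ {xs = []}     _             _     = z≤n
Unique-length-≤ {xs = x ∷ xs} {ys} (x∉xs ∷ !xs) xs⊆ys = begin
  suc (length xs)                          ≤⟨ s≤s (Unique-length-≤ !xs xs⊆ys∖x) ⟩
  suc (length (removeAt ys (index x∈ys)))  ≡⟨ length-removeAt′ ys (index x∈ys) ⟨
  length ys                                ∎
  where
  open ≤-Reasoning
  x∈ys = xs⊆ys (here refl)
  xs⊆ys∖x : xs ⊆ removeAt ys (index x∈ys)
  xs⊆ys∖x y∈xs = ∈-removeAt x∈ys (xs⊆ys (there y∈xs)) (λ { refl → All.lookup x∉xs y∈xs refl })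

image : (State p n → State q n) → List (State q n)
image {p} {n = n} f = deduplicate _≟ˢ_ (map f (allStates p n))

rank-∘-≤ : (φ : State q n → State p n) (g : Map q n) (ψ : State p n → State q n) →
           rank (φ ∘ g ∘ ψ) ≤ rank g
rank-∘-≤ φ g ψ = begin
  rank (φ ∘ g ∘ ψ)          ≤⟨ Unique-length-≤ (deduplicate-! _≟ˢ_ _) image⊆ ⟩
  length (map φ (image g))  ≡⟨ length-map φ (image g) ⟩
  rank g                    ∎
  where
  open ≤-Reasoning
  image⊆ : image (φ ∘ g ∘ ψ) ⊆ map φ (image g)
  image⊆ y∈ with ∈-map⁻ _ (∈-deduplicate⁻ _≟ˢ_ _ y∈)
  ... | x , _ , refl = ∈-map⁺ φ (∈-deduplicate⁺ _≟ˢ_ (∈-map⁺ g (∈-allStates (ψ x))))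

rank-cong : {f g : Map q n} → (∀ x → f x ≡ g x) → rank f ≡ rank g
rank-cong {q} {n} f≗g = cong (length ∘ deduplicate _≟ˢ_) (map-cong f≗g (allStates q n))

rank-≤-^ : (f : Map q n) → rank f ≤ q ^ n
rank-≤-^ {q} {n} f = ≤-trans (length-deduplicate _≟ˢ_ (map f (allStates q n)))
                    (≤-trans (≤-reflexive (length-map f (allStates q n))) (length-allStates-≤ q n))

SameIG : Map p n → Map q n → Set
SameIG f g = ∀ u v → IGArc f u v ⇔ IGArc g u v

InF-resp-SameIG : {D : Digraph n} {f : Map p n} {g : Map q n} → SameIG f g → InF D p f → InF D q g
InF-resp-SameIG {f = f} {g = g} f≈g f∈F u v = ⇔.trans (f∈F u v) (f≈g u v)

IGArc-resp-≗ : {f g : Map q n} → (∀ x → f x ≡ g x) → ∀ {u v} → IGArc f u v → IGArc g u v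
IGArc-resp-≗ f≗g {v = v} (a , b , a≈b , fa≢fb) =
  a , b , a≈b , λ ga≡gb → fa≢fb (trans (cong (λ s → lookup s v) (f≗g a))
                                (trans ga≡gb (cong (λ s → lookup s v) (sym (f≗g b)))))

≗⇒SameIG : {f g : Map q n} → (∀ x → f x ≡ g x) → SameIG f g
≗⇒SameIG f≗g u v = mk⇔ (IGArc-resp-≗ f≗g) (IGArc-resp-≗ (λ x → sym (f≗g x)))

∃-State? : {P : State q n → Set} → (∀ x → Dec (P x)) → Dec (∃ P)
∃-State? P? = map′ satisfied (λ (x , px) → lose (∈-allStates x) px) (any? P? (allStates _ _))

IGArc? : (f : Map q n) → ∀ u v → Dec (IGArc f u v)
IGArc? f u v = ∃-State? λ a → ∃-State? λ b →
  all? (λ w → ¬? (w ≟ᶠ u) →-dec (lookup a w ≟ᶠ lookup b w)) ×-dec ¬? (lookup (f a) v ≟ᶠ lookup (f b) v)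

_⇔-dec_ : ∀ {A B : Set} → Dec A → Dec B → Dec (A ⇔ B)
yes a ⇔-dec yes b = yes (mk⇔ (λ _ → b) (λ _ → a))
yes a ⇔-dec no ¬b = no λ A⇔B → ¬b (Equivalence.to A⇔B a)
no ¬a ⇔-dec yes b = no λ A⇔B → ¬a (Equivalence.from A⇔B b)
no ¬a ⇔-dec no ¬b = yes (mk⇔ (⊥-elim ∘ ¬a) (⊥-elim ∘ ¬b))

InF? : (D : Digraph n) (q : ℕ) (f : Map q n) → Dec (InF D q f)
InF? D q f = all? λ u → all? λ v → (D u v Bool.≟ true) ⇔-dec IGArc? f u v

override : ∀ {A B : Set} → DecidableEquality A → (A → B) → A → B → A → B
override _≟_ g a b x = if does (x ≟ a) then b else g x

functionsOn : ∀ {A B : Set} → DecidableEquality A → (A → B) → List A → List B → List (A → B)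
functionsOn _≟_ h []       bs = h ∷ []
functionsOn _≟_ h (a ∷ as) bs = concatMap (λ b → map (λ g → override _≟_ g a b) (functionsOn _≟_ h as bs)) bs

functionsOn-complete : ∀ {A B : Set} (_≟_ : DecidableEquality A) (h : A → B) (bs : List B) (g : A → B) →
  (∀ x → g x ∈ bs) → ∀ as → ∃[ g′ ] (g′ ∈ functionsOn _≟_ h as bs × (∀ {x} → x ∈ as → g′ x ≡ g x))
functionsOn-complete _≟_ h bs g g∈bs []       = h , here refl , λ ()
functionsOn-complete _≟_ h bs g g∈bs (a ∷ as) with functionsOn-complete _≟_ h bs g g∈bs as
... | g′ , g′∈ , g′≗g = override _≟_ g′ a (g a) , overridden∈ , agrees
  where
  overridden∈ : override _≟_ g′ a (g a) ∈ functionsOn _≟_ h (a ∷ as) bs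
  overridden∈ = ∈-concatMap⁺ _ (Any.map (λ { refl → ∈-map⁺ _ g′∈ }) (g∈bs a))
  agrees : ∀ {x} → x ∈ a ∷ as → override _≟_ g′ a (g a) x ≡ g x
  agrees {x} x∈ with x ≟ a | x∈
  ... | yes refl | _        = refl
  ... | no x≢a   | here x≡a = ⊥-elim (x≢a x≡a)
  ... | no _     | there x∈as = g′≗g x∈as

nonempty⇒minrankq : (D : Digraph n) → (∃[ f ] InF D q f) → ∃[ m ] IsMinrankq D q m
nonempty⇒minrankq {n} {q} D (f₀ , f₀∈F) = rank best , (best , best∈F , refl) , best≤
  where
  allMaps = functionsOn _≟ˢ_ f₀ (allStates q n) (allStates q n)
  candidates = filter (InF? D q) allMaps
  best = argmin rank f₀ candidates
  best∈F : InF D q best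
  best∈F = argmin-all rank {f₀} {candidates} {P = InF D q} f₀∈F (all-filter (InF? D q) allMaps)
  best≤ : ∀ f → InF D q f → rank best ≤ rank f
  best≤ f f∈F with functionsOn-complete _≟ˢ_ f₀ (allStates q n) f (∈-allStates ∘ f) (allStates q n)
  ... | g , g∈ , g≗f = ≤-trans (All.lookup (f[argmin]≤f[xs] f₀ candidates) g∈candidates)
                               (≤-reflexive (rank-cong g≗f′))
    where
    g≗f′ : ∀ x → g x ≡ f x
    g≗f′ x = g≗f (∈-allStates x)
    g∈candidates : g ∈ candidates
    g∈candidates =
      ∈-filter⁺ (InF? D q) g∈ (InF-resp-SameIG {f = f} {g = g} (≗⇒SameIG (λ x → sym (g≗f′ x))) f∈F)

module AndNetwork {n k : ℕ} (D : Digraph n) where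

  one : Fin (2 + k)
  one = Fin.suc Fin.zero

  InputsOne : State (2 + k) n → Fin n → Set
  InputsOne x v = ∀ w → D w v ≡ true → lookup x w ≡ one

  InputsOne? : ∀ x v → Dec (InputsOne x v)
  InputsOne? x v = all? λ w → (D w v Bool.≟ true) →-dec (lookup x w ≟ᶠ one)

  indicator : ∀ {A : Set} → Dec A → Fin (2 + k)
  indicator a? = if does a? then one else Fin.zero

  andNetwork : Map (2 + k) n
  andNetwork x = tabulate λ v → indicator (InputsOne? x v)

  andNetwork-at : ∀ x v → lookup (andNetwork x) v ≡ indicator (InputsOne? x v)
  andNetwork-at x v = lookup∘tabulate _ v

  indicator-≢ : ∀ {A B : Set} (a? : Dec A) (b? : Dec B) → A → ¬ B → indicator a? ≢ indicator b?
  indicator-≢ a? b? a ¬b rewrite dec-true a? a | dec-false b? ¬b = λ ()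

  arc⁺ : ∀ {u v} → D u v ≡ true → IGArc andNetwork u v
  arc⁺ {u} {v} Duv = ones , ones′ , (λ w w≢u → sym (lookup∘update′ w≢u ones Fin.zero)) , values≢
    where
    ones = replicate n one
    ones′ = ones [ u ]≔ Fin.zero
    values≢ : lookup (andNetwork ones) v ≢ lookup (andNetwork ones′) v
    values≢ rewrite andNetwork-at ones v | andNetwork-at ones′ v =
      indicator-≢ (InputsOne? ones v) (InputsOne? ones′ v) (λ w _ → lookup-replicate w one)
        (λ all-one → case trans (sym (lookup∘update u ones Fin.zero)) (all-one u Duv) of λ ())

  -- A change at a non-input u of v cannot change whether all inputs of v are one.
  arc⁻ : ∀ {u v} → IGArc andNetwork u v → D u v ≡ true
  arc⁻ {u} {v} (a , b , a≈b , fa≢fb) with D u v in Duv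
  ... | true  = refl
  ... | false = ⊥-elim (fa≢fb (begin
    lookup (andNetwork a) v    ≡⟨ andNetwork-at a v ⟩
    indicator (InputsOne? a v) ≡⟨ cong (if_then one else Fin.zero) same ⟩
    indicator (InputsOne? b v) ≡⟨ andNetwork-at b v ⟨
    lookup (andNetwork b) v    ∎))
    where
    open ≡-Reasoning
    transport : ∀ x y → (∀ w → w ≢ u → lookup x w ≡ lookup y w) → InputsOne x v → InputsOne y v
    transport x y x≈y x1 w Dwv with w ≟ᶠ u
    ... | yes refl = case trans (sym Dwv) Duv of λ ()
    ... | no w≢u   = trans (sym (x≈y w w≢u)) (x1 w Dwv)
    same = does-⇔ (mk⇔ (transport a b a≈b) (transport b a (λ w w≢u → sym (a≈b w w≢u))))
                  (InputsOne? a v) (InputsOne? b v)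

  andNetwork∈F : InF D (2 + k) andNetwork
  andNetwork∈F u v = mk⇔ arc⁺ arc⁻

recode : (Fin p → Fin q) → (Fin q → Fin p) → Map q n → Map p n
recode σ ρ f = Vec.map ρ ∘ f ∘ Vec.map σ

IGArc-recode⁻ : (σ : Fin p → Fin q) (ρ : Fin q → Fin p) (f : Map q n) →
                ∀ {u v} → IGArc (recode σ ρ f) u v → IGArc f u v
IGArc-recode⁻ σ ρ f {u} {v} (a , b , a≈b , ρfa≢ρfb) =
  Vec.map σ a , Vec.map σ b , σa≈σb , λ fa≡fb →
  ρfa≢ρfb (trans (lookup-map v ρ (f (Vec.map σ a)))
                 (trans (cong ρ fa≡fb) (sym (lookup-map v ρ (f (Vec.map σ b))))))
  where
  σa≈σb : ∀ w → w ≢ u → lookup (Vec.map σ a) w ≡ lookup (Vec.map σ b) w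
  σa≈σb w w≢u = trans (lookup-map w σ a) (trans (cong σ (a≈b w w≢u)) (sym (lookup-map w σ b)))

arcValues : (f : Map q n) → ∀ {u v} → IGArc f u v → List (Fin q)
arcValues f {v = v} (a , b , _ , _) = toList a ++ toList b ++ lookup (f a) v ∷ lookup (f b) v ∷ []

length-arcValues : (f : Map q n) → ∀ {u v} (w : IGArc f u v) → length (arcValues f w) ≡ n + (n + 2)
length-arcValues f (a , b , _ , _) =
  trans (length-++ (toList a))
        (cong₂ _+_ (length-toList a) (trans (length-++ (toList b)) (cong (_+ 2) (length-toList b))))

map-fixes : ∀ {A : Set} {h : A → A} {m} (xs : Vec A m) → (∀ {x} → x ∈ᵥ xs → h x ≡ x) → Vec.map h xs ≡ xs
map-fixes []       _     = refl
map-fixes (x ∷ xs) fixes = cong₂ _∷_ (fixes (VecAny.here refl)) (map-fixes xs (fixes ∘ VecAny.there))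

IGArc-recode⁺ : (σ : Fin p → Fin q) (ρ : Fin q → Fin p) (f : Map q n) →
                ∀ {u v} (w : IGArc f u v) → (∀ {x} → x ∈ arcValues f w → σ (ρ x) ≡ x) → IGArc (recode σ ρ f) u v
IGArc-recode⁺ σ ρ f {u} {v} (a , b , a≈b , fa≢fb) fixes =
  Vec.map ρ a , Vec.map ρ b , ρa≈ρb , ρfa≢ρfb
  where
  open ≡-Reasoning
  fixesᵃ : ∀ {x} → x ∈ᵥ a → σ (ρ x) ≡ x
  fixesᵃ = fixes ∘ ∈-++⁺ˡ ∘ ∈-toList⁺
  fixesᵇ : ∀ {x} → x ∈ᵥ b → σ (ρ x) ≡ x
  fixesᵇ = fixes ∘ ∈-++⁺ʳ (toList a) ∘ ∈-++⁺ˡ ∘ ∈-toList⁺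
  recode-at : ∀ t → (∀ {x} → x ∈ᵥ t → σ (ρ x) ≡ x) → lookup (recode σ ρ f (Vec.map ρ t)) v ≡ ρ (lookup (f t) v)
  recode-at t fixesᵗ = begin
    lookup (Vec.map ρ (f (Vec.map σ (Vec.map ρ t)))) v ≡⟨ cong (λ s → lookup (Vec.map ρ (f s)) v) roundtrip ⟩
    lookup (Vec.map ρ (f t)) v                         ≡⟨ lookup-map v ρ (f t) ⟩
    ρ (lookup (f t) v)                                 ∎
    where roundtrip = trans (sym (map-∘ σ ρ t)) (map-fixes t fixesᵗ)
  ρa≈ρb : ∀ w → w ≢ u → lookup (Vec.map ρ a) w ≡ lookup (Vec.map ρ b) w
  ρa≈ρb w w≢u = trans (lookup-map w ρ a) (trans (cong ρ (a≈b w w≢u)) (sym (lookup-map w ρ b)))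
  ρfa≢ρfb : lookup (recode σ ρ f (Vec.map ρ a)) v ≢ lookup (recode σ ρ f (Vec.map ρ b)) v
  ρfa≢ρfb eq = fa≢fb (begin
    lookup (f a) v         ≡⟨ fixes (∈-++⁺ʳ (toList a) (∈-++⁺ʳ (toList b) (here refl))) ⟨
    σ (ρ (lookup (f a) v)) ≡⟨ cong σ (trans (sym (recode-at a fixesᵃ)) (trans eq (recode-at b fixesᵇ))) ⟩
    σ (ρ (lookup (f b) v)) ≡⟨ fixes (∈-++⁺ʳ (toList a) (∈-++⁺ʳ (toList b) (there (here refl)))) ⟩
    lookup (f b) v         ∎)

retractionOnto : (W : List (Fin (suc q))) → length W ≤ suc p →
  Σ[ σ ∈ (Fin (suc p) → Fin (suc q)) ] Σ[ ρ ∈ (Fin (suc q) → Fin (suc p)) ] (∀ {x} → x ∈ W → σ (ρ x) ≡ x)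
retractionOnto {q} {p} W |W|≤ = σ , ρ , σρ
  where
  entry : ∀ {m} → Dec (m < length W) → Fin (suc q)
  entry (yes m<|W|) = List.lookup W (fromℕ< m<|W|)
  entry (no _)      = Fin.zero
  position : ∀ x → Dec (x ∈ W) → Fin (suc p)
  position _ (yes x∈W) = inject≤ (index x∈W) |W|≤
  position _ (no _)    = Fin.zero
  σ : Fin (suc p) → Fin (suc q)
  σ i = entry (toℕ i <? length W)
  ρ : Fin (suc q) → Fin (suc p)
  ρ x = position x (any? (x ≟ᶠ_) W)
  σ∘inject≤ : ∀ i → σ (inject≤ i |W|≤) ≡ List.lookup W i
  σ∘inject≤ i with toℕ (inject≤ i |W|≤) <? length W
  ... | yes i<|W| = cong (List.lookup W) (toℕ-injective (trans (toℕ-fromℕ< i<|W|) (toℕ-inject≤ i |W|≤)))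
  ... | no  i≮|W| = ⊥-elim (i≮|W| (subst (_< length W) (sym (toℕ-inject≤ i |W|≤)) (toℕ<n i)))
  σ∘position : ∀ x (x∈W? : Dec (x ∈ W)) → x ∈ W → σ (position x x∈W?) ≡ x
  σ∘position _ (yes x∈W) _   = trans (σ∘inject≤ (index x∈W)) (sym (lookup-index x∈W))
  σ∘position _ (no x∉W)  x∈W = ⊥-elim (x∉W x∈W)
  σρ : ∀ {x} → x ∈ W → σ (ρ x) ≡ x
  σρ {x} = σ∘position x (any? (x ≟ᶠ_) W)

simulateOn : (f : Map (suc q) n) (W : List (Fin (suc q))) → length W ≤ suc p →
  (∀ {u v} → IGArc f u v → Σ[ w ∈ IGArc f u v ] arcValues f w ⊆ W) →
  Σ[ g ∈ Map (suc p) n ] (SameIG f g × rank g ≤ rank f)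
simulateOn f W |W|≤ witnessedIn with retractionOnto W |W|≤
... | σ , ρ , σρ = recode σ ρ f , sameIG , rank-∘-≤ (Vec.map ρ) f (Vec.map σ)
  where
  sameIG : SameIG f (recode σ ρ f)
  sameIG u v = mk⇔ (λ arc → IGArc-recode⁺ σ ρ f (proj₁ (witnessedIn arc)) (σρ ∘ proj₂ (witnessedIn arc)))
                   (IGArc-recode⁻ σ ρ f)

enlargeAlphabet : ∀ {k} → suc k ≤ q → (f : Map (suc k) n) → Σ[ g ∈ Map q n ] (SameIG f g × rank g ≤ rank f)
enlargeAlphabet {k = k} (s≤s k≤q) f =
  simulateOn f (allFin (suc k)) (≤-trans (≤-reflexive (length-allFin (suc k))) (s≤s k≤q))
             λ arc → arc , λ _ → ∈-allFin _

decidedArcValues : (f : Map q n) → ∀ {u v} → Dec (IGArc f u v) → List (Fin q)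
decidedArcValues f (yes w) = arcValues f w
decidedArcValues f (no _)  = []

decidedArcValues-witness : (f : Map q n) → ∀ {u v} (arc? : Dec (IGArc f u v)) → IGArc f u v →
                           Σ[ w ∈ IGArc f u v ] arcValues f w ⊆ decidedArcValues f arc?
decidedArcValues-witness f (yes w) _   = w , λ x∈ → x∈
decidedArcValues-witness f (no ¬w) arc = ⊥-elim (¬w arc)

witnessValues : Map q n → List (Fin q)
witnessValues {n = n} f =
  concatMap (λ u → concatMap (λ v → decidedArcValues f (IGArc? f u v)) (allFin n)) (allFin n)

witnessBound : ℕ → ℕ
witnessBound n = n * (n * (n + (n + 2)))

length-witnessValues-≤ : (f : Map q n) → length (witnessValues f) ≤ witnessBound n
length-witnessValues-≤ {n = n} f =
  ≤-trans (length-concatMap-≤ _ (λ u → ≤-trans (length-concatMap-≤ _ (decided≤ u) (allFin n))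
                                               (≤-reflexive (cong (_* (n + (n + 2))) (length-allFin n))))
                              (allFin n))
          (≤-reflexive (cong (_* (n * (n + (n + 2)))) (length-allFin n)))
  where
  decided≤ : ∀ u v → length (decidedArcValues f (IGArc? f u v)) ≤ n + (n + 2)
  decided≤ u v with IGArc? f u v
  ... | yes w = ≤-reflexive (length-arcValues f w)
  ... | no _  = z≤n

smallAlphabet : ℕ → ℕ
smallAlphabet n = 2 + witnessBound n

2≤smallAlphabet : ∀ n → 2 ≤ smallAlphabet n
2≤smallAlphabet n = s≤s (s≤s z≤n)

shrinkAlphabet : ∀ {k} (f : Map (suc k) n) → Σ[ g ∈ Map (smallAlphabet n) n ] (SameIG f g × rank g ≤ rank f)
shrinkAlphabet {n} f =
  simulateOn f (witnessValues f) (m≤n⇒m≤1+n (m≤n⇒m≤1+n (length-witnessValues-≤ f))) witnessedIn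
  where
  witnessedIn : ∀ {u v} → IGArc f u v → Σ[ w ∈ IGArc f u v ] arcValues f w ⊆ witnessValues f
  witnessedIn {u} {v} arc with decidedArcValues-witness f (IGArc? f u v) arc
  ... | w , w⊆ = w , λ x∈ → ∈-concatMap⁺ _ (Any.map (λ { refl →
                   ∈-concatMap⁺ _ (Any.map (λ { refl → w⊆ x∈ }) (∈-allFin v)) }) (∈-allFin u))

module _ {n : ℕ} (D : Digraph n) where

  minrankq-exists : ∀ q → 2 ≤ q → ∃[ m ] IsMinrankq D q m
  minrankq-exists (suc (suc k)) (s≤s (s≤s z≤n)) = nonempty⇒minrankq D (andNetwork , andNetwork∈F)
    where open AndNetwork {k = k} D

  minrankq-antitone : ∀ {k q m m′} → suc k ≤ q → IsMinrankq D (suc k) m → IsMinrankq D q m′ → m′ ≤ m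
  minrankq-antitone k<q ((f , f∈F , refl) , _) (_ , minimal) with enlargeAlphabet k<q f
  ... | g , f≈g , g≤f = ≤-trans (minimal g (InF-resp-SameIG {f = f} {g = g} f≈g f∈F)) g≤f

  minrankq-small-≤ : ∀ {q m m′} → 2 ≤ q → IsMinrankq D (smallAlphabet n) m → IsMinrankq D q m′ → m ≤ m′
  minrankq-small-≤ (s≤s _) (_ , minimal) ((f , f∈F , refl) , _) with shrinkAlphabet f
  ... | g , f≈g , g≤f = ≤-trans (minimal g (InF-resp-SameIG {f = f} {g = g} f≈g f∈F)) g≤f

  minrankq-stable : ∀ {q m} → 2 ≤ q → smallAlphabet n ≤ q → IsMinrankq D (smallAlphabet n) m → IsMinrankq D q m
  minrankq-stable {q} 2≤q B≤q minₛ with minrankq-exists q 2≤q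
  ... | m , min =
    subst (IsMinrankq D q) (≤-antisym (minrankq-antitone B≤q minₛ min) (minrankq-small-≤ 2≤q minₛ min)) min

  minrankq-≤-^ : ∀ {q m} → IsMinrankq D q m → m ≤ q ^ n
  minrankq-≤-^ ((f , _ , refl) , _) = rank-≤-^ f

corollary3p2 : (n : ℕ) (D : Digraph n) →
    -- minrank[D,q] is well defined for every q ≥ 2
    (∀ q → 2 ≤ q → ∃[ m ] IsMinrankq D q m)
    × (∃[ m ] ∃[ m₂ ]
        ( IsMinrank D m
        × IsMinrankq D 2 m₂
        -- minrank[D] = lim_{q→∞} minrank[D,q]  (ℕ-valued: eventually equal)
        × (∃[ Q ] ∀ q → 2 ≤ q → Q ≤ q → IsMinrankq D q m)
        × m ≤ m₂
        × m₂ ≤ 2 ^ n))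
corollary3p2 n D with minrankq-exists D (smallAlphabet n) (2≤smallAlphabet n) | minrankq-exists D 2 ≤-refl
... | mₛ , minₛ | m₂ , min₂ =
  minrankq-exists D , mₛ , m₂ ,
  (((smallAlphabet n , 2≤smallAlphabet n , minₛ) , λ _ _ 2≤q → minrankq-small-≤ D 2≤q minₛ) ,
   min₂ ,
   (smallAlphabet n , λ _ 2≤q B≤q → minrankq-stable D 2≤q B≤q minₛ) ,
   minrankq-small-≤ D ≤-refl minₛ min₂ ,
   minrankq-≤-^ D min₂)
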